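{- Let $n,m \in \mathbb{Z}^+$ with $n \geq 2$ and $m \geq 1$, and let $T_m$ be the rooted complete $m$-ary tree of infinite height. Then \[ \chi_{(n)}(T_m) = \begin{cases} 2, &\text{if } n \nmid m \text{ and } n \nmid (m+1), \\ 4, &\text{if } n = 2 \text{ and } m \text{ is odd}, \\ 3, &\text{otherwise}. \end{cases}\]
   Context: $T_m$ is the infinite rooted tree in which every vertex has exactly $m$ children. For a graph $G=(V,E)$, a $\mathbb{Z}$-labeling is a map $\ell:V\to\mathbb{Z}$; its order is the size of its range; it is proper if adjacent vertices get different labels. $N(v)$ is the open neighborhood of $v$. An open coloring with nonzero remainders mod $n$ is a labeling with $\sum_{w\in N(v)}\ell(w)\not\equiv 0 \pmod n$ for all $v\in V$. $\chi_{(n)}(G)$ is the minimum order of a proper open coloring with nonzero remainders mod $n$ of $G$. -}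

module Defs where

open import Data.Nat using (ℕ; _≤_)
open import Data.Fin using (Fin)
open import Data.List using (List; []; _∷_; map; allFin)
open import Data.Integer using (ℤ; +_; _+_)
import Data.Integer.Divisibility as ℤD
open import Data.Product using (Σ; ∃; _×_)
open import Relation.Binary.PropositionalEquality using (_≡_; _≢_)
open import Relation.Nullary using (¬_)
open import Function.Definitions using (Injective)

-- Vertices of T_m: finite words over Fin m (the path from the root),
-- stored with the most recent step at the head.  The root is [];
-- the children of v are  i ∷ v  (i : Fin m); the parent of i ∷ v is v.
-- Every edge of T_m is of the form {v , i ∷ v}.
Vertex : ℕ → Set
Vertex m = List (Fin m)

Labeling : ℕ → Set
Labeling m = Vertex m → ℤ

sumℤ : List ℤ → ℤ
sumℤ [] = + 0
sumℤ (x ∷ xs) = x + sumℤ xs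

parentTerm : ∀ {m} → Labeling m → Vertex m → ℤ
parentTerm ℓ [] = + 0
parentTerm ℓ (_ ∷ v) = ℓ v

nbrSum : ∀ {m} → Labeling m → Vertex m → ℤ
nbrSum {m} ℓ v = sumℤ (map (λ i → ℓ (i ∷ v)) (allFin m)) + parentTerm ℓ v

Proper : ∀ {m} → Labeling m → Set
Proper {m} ℓ = ∀ (v : Vertex m) (i : Fin m) → ℓ (i ∷ v) ≢ ℓ v

OpenNZ : ∀ {m} → ℕ → Labeling m → Set
OpenNZ {m} n ℓ = ∀ (v : Vertex m) → ¬ ((+ n) ℤD.∣ nbrSum ℓ v)

ProperOpenNZ : ∀ {m} → ℕ → Labeling m → Set
ProperOpenNZ n ℓ = Proper ℓ × OpenNZ n ℓ

HasOrder : ∀ {m} → Labeling m → ℕ → Set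
HasOrder {m} ℓ k = Σ (Fin k → ℤ) λ c →
  Injective _≡_ _≡_ c ×
  (∀ (v : Vertex m) → ∃ λ j → ℓ v ≡ c j) ×
  (∀ (j : Fin k) → ∃ λ (v : Vertex m) → ℓ v ≡ c j)

ChiN : ℕ → ℕ → ℕ → Set
ChiN n m k =
  (∃ λ (ℓ : Labeling m) → ProperOpenNZ n ℓ × HasOrder ℓ k) ×
  (∀ (ℓ : Labeling m) (j : ℕ) → ProperOpenNZ n ℓ → HasOrder ℓ j → k ≤ j)

-- In a proper labeling with two values the labels alternate along edges, so all
-- neighbours of a vertex share one label P and its neighbour sum is (degree) * P: divisible by n
-- at the root if n ∣ m, and at any other vertex if n ∣ m + 1.  For n = 2 and m odd, among at most
-- three values there is one, d, such that all the others have the same parity.  A non-root vertex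
-- none of whose m + 1 neighbours is labelled d then has an even neighbour sum; hence no non-root
-- vertex is labelled d (its neighbours differ from it), and then a vertex at depth 2 has no
-- neighbour labelled d at all.
--
-- Upper bounds come from labelings computed by a small automaton walking down from the root: the
-- labels 1 and n + 1 alternating with depth; 0, 1, 3, 2 repeating with depth (n = 2, m odd);
-- 0, 1, 2 repeating with depth (n ∣ m + 1, n ≥ 3); and, when n ∣ m, the alternating labeling
-- modified so that the root, and every child of a vertex labelled 0, gives its first child label 0.
module Submission where

open import Defs
open import Data.Nat using (ℕ; _≤_; suc)
open import Data.Nat.Divisibility using (_∣_)
open import Data.Product using (_×_)
open import Relation.Binary.PropositionalEquality using (_≡_)
open import Relation.Nullary using (¬_)

open import Data.Nat using (zero; _+_; _*_; _<_; _≤?_; s≤s; z≤n)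
open import Data.Nat.Divisibility
  using (_∣?_; _∣0; ∣-refl; ∣m∣n⇒∣m+n; ∣m+n∣m⇒∣n; ∣m⇒∣m*n; n∣m*n; >⇒∤)
open import Data.Nat.Properties
  using (+-comm; +-identityʳ; *-suc; *-identityʳ; ≤-refl; <⇒≤; ≰⇒>; m≤n⇒∃[o]m+o≡n)
open import Data.Nat.ListAction using (sum)
open import Data.Nat.Tactic.RingSolver using (solve-∀)
open import Data.Integer as ℤ using (ℤ; +_)
import Data.Integer.Properties as ℤ
import Data.Integer.Tactic.RingSolver as ℤ
open import Data.Integer.Divisibility using () renaming (_∣_ to _∣ᵤ_)
open import Data.Integer.Divisibility.Signed as ℤ∣ using (∣⇒∣ᵤ; ∣ᵤ⇒∣) renaming (_∣_ to _∣ℤ_)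
open import Data.Integer.DivMod using (_/ℕ_; _%ℕ_; a≡a%ℕn+[a/ℕn]*n; n%ℕd<d)
open import Data.Fin using (Fin; splitAt; _↑ˡ_)
open import Data.Fin.Patterns using (0F; 1F; 2F; 3F)
open import Data.Fin.Properties using (splitAt-↑ˡ)
open import Data.List using ([]; _∷_; map; allFin; tabulate; length)
open import Data.List.Properties using (map-tabulate; length-tabulate)
open import Data.Product using (Σ; ∃; ∃₂; _,_; proj₁)
open import Data.Empty using (⊥)
open import Data.Sum using (_⊎_; inj₁; inj₂; [_,_]′)
open import Function using (id; _∘_; const)
open import Function.Consequences.Propositional using (inverseʳ⇒injective; strictlyInverseʳ⇒inverseʳ)
open import Relation.Binary.PropositionalEquality using (_≢_; refl; sym; trans; cong; subst)
open import Relation.Nullary using (yes; no; contradiction)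
open import Relation.Nullary.Decidable using (decidable-stable; _⊎-dec_)

∣⇒∤suc : ∀ {n a} → 2 ≤ n → n ∣ a → ¬ n ∣ suc a
∣⇒∤suc {n} {a} 2≤n n∣a n∣1+a = >⇒∤ 2≤n (∣m+n∣m⇒∣n (subst (n ∣_) (+-comm 1 a) n∣1+a) n∣a)

∣suc⇒∤ : ∀ {n a} → 2 ≤ n → n ∣ suc a → ¬ n ∣ a
∣suc⇒∤ 2≤n n∣1+a n∣a = ∣⇒∤suc 2≤n n∣a n∣1+a

2∣⊎2∣suc : ∀ m → 2 ∣ m ⊎ 2 ∣ suc m
2∣⊎2∣suc zero    = inj₁ (2 ∣0)
2∣⊎2∣suc (suc m) = [ inj₂ ∘ ∣m∣n⇒∣m+n ∣-refl , inj₁ ]′ (2∣⊎2∣suc m)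

2∤⇒2∣suc : ∀ {m} → ¬ 2 ∣ m → 2 ∣ suc m
2∤⇒2∣suc {m} 2∤m = [ (λ 2∣m → contradiction 2∣m 2∤m) , id ]′ (2∣⊎2∣suc m)

∤⇒∤*1 : ∀ {n a} → ¬ n ∣ a → ¬ n ∣ a * 1
∤⇒∤*1 {n} {a} n∤a = n∤a ∘ subst (n ∣_) (*-identityʳ a)

∤⇒∤*suc : ∀ {n a} → ¬ n ∣ a → ¬ n ∣ a * suc n
∤⇒∤*suc {n} {a} n∤a n∣a[1+n] =
  n∤a (∣m+n∣m⇒∣n (subst (n ∣_) (trans (*-suc a n) (+-comm a (a * n))) n∣a[1+n]) (n∣m*n a))

∤suc*⇒∤*+ : ∀ {n} m c → ¬ n ∣ suc m * c → ¬ n ∣ m * c + c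
∤suc*⇒∤*+ {n} m c n∤ = n∤ ∘ subst (n ∣_) (+-comm (m * c) c)

-- When n ∣ m + 1, m acts as -1 modulo n: the first sum is ≡ -d and the second ≡ d.

∤m*[b+d]+b : ∀ {n m b d} → n ∣ suc m → ¬ n ∣ d → ¬ n ∣ m * (b + d) + b
∤m*[b+d]+b {n} {m} {b} {d} n∣1+m n∤d n∣ =
  n∤d (∣m+n∣m⇒∣n (subst (n ∣_) (regroup m b d) (∣m⇒∣m*n (b + d) n∣1+m)) n∣)
  where
  regroup : ∀ m b d → suc m * (b + d) ≡ (m * (b + d) + b) + d
  regroup = solve-∀

∤m*a+[a+d] : ∀ {n m a d} → n ∣ suc m → ¬ n ∣ d → ¬ n ∣ m * a + (a + d)
∤m*a+[a+d] {n} {m} {a} {d} n∣1+m n∤d n∣ =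
  n∤d (∣m+n∣m⇒∣n (subst (n ∣_) (regroup m a d) n∣) (∣m⇒∣m*n a n∣1+m))
  where
  regroup : ∀ m a d → m * a + (a + d) ≡ suc m * a + d
  regroup = solve-∀

-- A record rather than a synonym for + n ∣ x - y, so that x, y and n remain inferable.
infix 4 _≡_[mod_]
record _≡_[mod_] (x y : ℤ) (n : ℕ) : Set where
  constructor mod-divides
  field
    divides-difference : + n ∣ℤ x ℤ.- y

≡⇒≡[mod] : ∀ {n x y} → x ≡ y → x ≡ y [mod n ]
≡⇒≡[mod] {x = x} refl = mod-divides (ℤ∣.divides (+ 0) (ℤ.+-inverseʳ x))

≡+*⇒≡[mod] : ∀ {n x r} q → x ≡ r ℤ.+ q ℤ.* + n → x ≡ r [mod n ]
≡+*⇒≡[mod] {n} {r = r} q refl = mod-divides (ℤ∣.divides q (cancel r (q ℤ.* + n)))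
  where
  cancel : ∀ r s → (r ℤ.+ s) ℤ.- r ≡ s
  cancel = ℤ.solve-∀

≡[mod]-+ : ∀ {n x x′ y y′} → x ≡ x′ [mod n ] → y ≡ y′ [mod n ] → x ℤ.+ y ≡ x′ ℤ.+ y′ [mod n ]
≡[mod]-+ {n} {x} {x′} {y} {y′} (mod-divides n∣x-x′) (mod-divides n∣y-y′) =
  mod-divides (subst (+ n ∣ℤ_) (regroup x x′ y y′) (ℤ∣.∣m∣n⇒∣m+n n∣x-x′ n∣y-y′))
  where
  regroup : ∀ x x′ y y′ → (x ℤ.- x′) ℤ.+ (y ℤ.- y′) ≡ (x ℤ.+ y) ℤ.- (x′ ℤ.+ y′)
  regroup = ℤ.solve-∀

∣-resp-≡[mod] : ∀ {n x y} → x ≡ y [mod n ] → + n ∣ℤ y → + n ∣ℤ x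
∣-resp-≡[mod] {n} {x} {y} (mod-divides n∣x-y) n∣y =
  subst (+ n ∣ℤ_) (regroup x y) (ℤ∣.∣m∣n⇒∣m+n n∣x-y n∣y)
  where
  regroup : ∀ x y → (x ℤ.- y) ℤ.+ y ≡ x
  regroup = ℤ.solve-∀

parity : ∀ x → (x ≡ + 0 [mod 2 ]) ⊎ (x ≡ + 1 [mod 2 ])
parity x with x %ℕ 2 | a≡a%ℕn+[a/ℕn]*n x 2 | n%ℕd<d x 2
... | 0           | x≡r+q*2 | _ = inj₁ (≡+*⇒≡[mod] {r = + 0} (x /ℕ 2) x≡r+q*2)
... | 1           | x≡r+q*2 | _ = inj₂ (≡+*⇒≡[mod] {r = + 1} (x /ℕ 2) x≡r+q*2)
... | suc (suc _) | _       | s≤s (s≤s ())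

module _ (c : Fin 3 → ℤ) where

  OddOneOut : Set
  OddOneOut = ∃₂ λ d P → ∀ j → c j ≡ d ⊎ (c j ≡ P [mod 2 ])

  private
    allBut0F : ∀ {P} → c 1F ≡ P [mod 2 ] → c 2F ≡ P [mod 2 ] → OddOneOut
    allBut0F p₁ p₂ = _ , _ , λ { 0F → inj₁ refl ; 1F → inj₂ p₁ ; 2F → inj₂ p₂ }

    allBut1F : ∀ {P} → c 0F ≡ P [mod 2 ] → c 2F ≡ P [mod 2 ] → OddOneOut
    allBut1F p₀ p₂ = _ , _ , λ { 0F → inj₂ p₀ ; 1F → inj₁ refl ; 2F → inj₂ p₂ }

    allBut2F : ∀ {P} → c 0F ≡ P [mod 2 ] → c 1F ≡ P [mod 2 ] → OddOneOut
    allBut2F p₀ p₁ = _ , _ , λ { 0F → inj₂ p₀ ; 1F → inj₂ p₁ ; 2F → inj₁ refl }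

  oddOneOut : OddOneOut
  oddOneOut with parity (c 0F) | parity (c 1F) | parity (c 2F)
  ... | inj₁ p₀ | inj₁ p₁ | _       = allBut2F p₀ p₁
  ... | inj₂ p₀ | inj₂ p₁ | _       = allBut2F p₀ p₁
  ... | inj₁ p₀ | inj₂ _  | inj₁ p₂ = allBut1F p₀ p₂
  ... | inj₂ p₀ | inj₁ _  | inj₂ p₂ = allBut1F p₀ p₂
  ... | inj₁ _  | inj₂ p₁ | inj₂ p₂ = allBut0F p₁ p₂
  ... | inj₂ _  | inj₁ p₁ | inj₁ p₂ = allBut0F p₁ p₂

sumℤ-≡[mod] : ∀ {A : Set} {n P} (f : A → ℤ) → (∀ a → f a ≡ P [mod n ]) →
              ∀ xs → sumℤ (map f xs) ≡ + length xs ℤ.* P [mod n ]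
sumℤ-≡[mod] f f≡P []                 = ≡⇒≡[mod] refl
sumℤ-≡[mod] {n = n} {P} f f≡P (a ∷ xs) =
  subst (λ y → _ ≡ y [mod n ]) (sym (ℤ.suc-* (+ length xs) P))
        (≡[mod]-+ (f≡P a) (sumℤ-≡[mod] f f≡P xs))

sumℤ-allFin-≡[mod] : ∀ {n m P} (f : Fin m → ℤ) → (∀ i → f i ≡ P [mod n ]) →
                     sumℤ (map f (allFin m)) ≡ + m ℤ.* P [mod n ]
sumℤ-allFin-≡[mod] {n} {m} {P} f f≡P =
  subst (λ k → sumℤ (map f (allFin m)) ≡ + k ℤ.* P [mod n ]) (length-tabulate {n = m} id)
        (sumℤ-≡[mod] f f≡P (allFin m))

nbrSum-[]-divisible : ∀ {n m P} (ℓ : Labeling m) → n ∣ m → (∀ i → ℓ (i ∷ []) ≡ P [mod n ]) →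
                      + n ∣ℤ nbrSum ℓ []
nbrSum-[]-divisible {n} {m} {P} ℓ n∣m children =
  ∣-resp-≡[mod] (≡[mod]-+ (sumℤ-allFin-≡[mod] _ children) (≡⇒≡[mod] refl))
                (ℤ∣.∣m∣n⇒∣m+n (ℤ∣.∣m⇒∣m*n P (∣ᵤ⇒∣ {+ n} {+ m} n∣m)) (ℤ∣.divides (+ 0) refl))

nbrSum-∷-divisible : ∀ {n m P} (ℓ : Labeling m) i v → n ∣ suc m →
                     (∀ j → ℓ (j ∷ i ∷ v) ≡ P [mod n ]) → ℓ v ≡ P [mod n ] →
                     + n ∣ℤ nbrSum ℓ (i ∷ v)
nbrSum-∷-divisible {n} {m} {P} ℓ i v n∣1+m children parent =
  ∣-resp-≡[mod] (≡[mod]-+ (sumℤ-allFin-≡[mod] _ children) parent)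
                (subst (+ n ∣ℤ_) (trans (ℤ.suc-* (+ m) P) (ℤ.+-comm P (+ m ℤ.* P)))
                       (ℤ∣.∣m⇒∣m*n P (∣ᵤ⇒∣ {+ n} {+ suc m} n∣1+m)))

OrderAtMost : ∀ {m} → Labeling m → ℕ → Set
OrderAtMost {m} ℓ k = Σ (Fin k → ℤ) λ c → ∀ (v : Vertex m) → ∃ λ j → ℓ v ≡ c j

orderAtMost-+ : ∀ {m j} {ℓ : Labeling m} r → OrderAtMost ℓ j → OrderAtMost ℓ (j + r)
orderAtMost-+ {j = j} {ℓ} r (c , cover) = c′ , λ v → covered (cover v)
  where
  c′ = [ c , const (ℓ []) ]′ ∘ splitAt j
  covered : ∀ {x} → ∃ (λ i → x ≡ c i) → ∃ λ i → x ≡ c′ i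
  covered (i , x≡ci) = i ↑ˡ r , trans x≡ci (cong [ c , const (ℓ []) ]′ (sym (splitAt-↑ˡ j i r)))

¬orderAtMost⇒< : ∀ {m k j} {ℓ : Labeling m} → ¬ OrderAtMost ℓ k → HasOrder ℓ j → k < j
¬orderAtMost⇒< {k = k} {j} {ℓ} ¬≤k (c , _ , cover , _) with j ≤? k
... | no j≰k  = ≰⇒> j≰k
... | yes j≤k = let (r , j+r≡k) = m≤n⇒∃[o]m+o≡n j≤k in
  contradiction (subst (OrderAtMost ℓ) j+r≡k (orderAtMost-+ r (c , cover))) ¬≤k

proper⇒¬orderAtMost1 : ∀ {m} {ℓ : Labeling (suc m)} → Proper ℓ → ¬ OrderAtMost ℓ 1
proper⇒¬orderAtMost1 proper (c , cover) with cover [] | cover (0F ∷ [])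
... | 0F , ℓ[]≡c | 0F , ℓ0≡c = proper [] 0F (trans ℓ0≡c (sym ℓ[]≡c))

twoValued-≢⇒≡ : ∀ {A : Set} {a b x y z : A} → x ≡ a ⊎ x ≡ b → y ≡ a ⊎ y ≡ b → z ≡ a ⊎ z ≡ b →
                x ≢ z → y ≢ z → x ≡ y
twoValued-≢⇒≡ (inj₁ refl) (inj₁ refl) _           _   _   = refl
twoValued-≢⇒≡ (inj₂ refl) (inj₂ refl) _           _   _   = refl
twoValued-≢⇒≡ (inj₁ refl) (inj₂ refl) (inj₁ refl) x≢z _   = contradiction refl x≢z
twoValued-≢⇒≡ (inj₁ refl) (inj₂ refl) (inj₂ refl) _   y≢z = contradiction refl y≢z
twoValued-≢⇒≡ (inj₂ refl) (inj₁ refl) (inj₁ refl) _   y≢z = contradiction refl y≢z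
twoValued-≢⇒≡ (inj₂ refl) (inj₁ refl) (inj₂ refl) x≢z _   = contradiction refl x≢z

orderAtMost2-≢⇒≡ : ∀ {m} {ℓ : Labeling m} → OrderAtMost ℓ 2 →
                   ∀ u w z → ℓ u ≢ ℓ z → ℓ w ≢ ℓ z → ℓ u ≡ ℓ w
orderAtMost2-≢⇒≡ {ℓ = ℓ} (c , cover) u w z = twoValued-≢⇒≡ (twoValued u) (twoValued w) (twoValued z)
  where
  twoValued : ∀ v → ℓ v ≡ c 0F ⊎ ℓ v ≡ c 1F
  twoValued v with cover v
  ... | 0F , ℓv≡c = inj₁ ℓv≡c
  ... | 1F , ℓv≡c = inj₂ ℓv≡c

¬orderAtMost2 : ∀ {n m} {ℓ : Labeling (suc m)} → n ∣ suc m ⊎ n ∣ suc (suc m) →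
                ProperOpenNZ n ℓ → ¬ OrderAtMost ℓ 2
¬orderAtMost2 {ℓ = ℓ} (inj₁ n∣m) (proper , nonzero) atMost2 =
  nonzero [] (∣⇒∣ᵤ (nbrSum-[]-divisible ℓ n∣m λ i → ≡⇒≡[mod]
    (orderAtMost2-≢⇒≡ atMost2 (i ∷ []) (0F ∷ []) [] (proper [] i) (proper [] 0F))))
¬orderAtMost2 {ℓ = ℓ} (inj₂ n∣1+m) (proper , nonzero) atMost2 =
  nonzero (0F ∷ []) (∣⇒∣ᵤ (nbrSum-∷-divisible ℓ 0F [] n∣1+m
    (λ j → ≡⇒≡[mod] (orderAtMost2-≢⇒≡ atMost2 (j ∷ 0F ∷ []) [] (0F ∷ [])
                                        (proper (0F ∷ []) j) (proper [] 0F ∘ sym)))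
    (≡⇒≡[mod] refl)))

¬oddOneOut : ∀ {m} {ℓ : Labeling (suc m)} → 2 ∣ suc (suc m) → ProperOpenNZ 2 ℓ →
             ∀ d P → ¬ (∀ v → ℓ v ≡ d ⊎ (ℓ v ≡ P [mod 2 ]))
¬oddOneOut {ℓ = ℓ} 2∣1+m (proper , nonzero) d P split =
  someNeighbour≡d 0F (0F ∷ []) (λ j → nonRoot≢d j (0F ∷ 0F ∷ [])) (nonRoot≢d 0F [])
  where
  ≢d⇒≡P : ∀ v → ℓ v ≢ d → ℓ v ≡ P [mod 2 ]
  ≢d⇒≡P v ℓv≢d = [ (λ ℓv≡d → contradiction ℓv≡d ℓv≢d) , id ]′ (split v)

  someNeighbour≡d : ∀ i u → (∀ j → ℓ (j ∷ i ∷ u) ≢ d) → ℓ u ≢ d → ⊥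
  someNeighbour≡d i u children parent = nonzero (i ∷ u) (∣⇒∣ᵤ (nbrSum-∷-divisible ℓ i u 2∣1+m
    (λ j → ≢d⇒≡P (j ∷ i ∷ u) (children j)) (≢d⇒≡P u parent)))

  nonRoot≢d : ∀ i u → ℓ (i ∷ u) ≢ d
  nonRoot≢d i u ℓiu≡d = someNeighbour≡d i u
    (λ j ℓjiu≡d → proper (i ∷ u) j (trans ℓjiu≡d (sym ℓiu≡d)))
    (λ ℓu≡d → proper u i (trans ℓiu≡d (sym ℓu≡d)))

¬orderAtMost3 : ∀ {m} {ℓ : Labeling (suc m)} → 2 ∣ suc (suc m) → ProperOpenNZ 2 ℓ →
                ¬ OrderAtMost ℓ 3
¬orderAtMost3 {ℓ = ℓ} 2∣1+m po (c , cover) with oddOneOut c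
... | d , P , split = ¬oddOneOut 2∣1+m po d P λ v → transport (cover v)
  where
  transport : ∀ {x} → ∃ (λ j → x ≡ c j) → x ≡ d ⊎ (x ≡ P [mod 2 ])
  transport (j , x≡cj) =
    [ inj₁ ∘ trans x≡cj , inj₂ ∘ subst (λ y → y ≡ P [mod 2 ]) (sym x≡cj) ]′ (split j)

sum-tabulate-const : ∀ k c → sum (tabulate {n = k} (const c)) ≡ k * c
sum-tabulate-const zero    c = refl
sum-tabulate-const (suc k) c = cong (λ s → c + s) (sum-tabulate-const k c)

sumℤ-tabulate-+ : ∀ {k} (g : Fin k → ℕ) → sumℤ (tabulate (λ i → + g i)) ≡ + sum (tabulate g)
sumℤ-tabulate-+ {zero}  g = refl
sumℤ-tabulate-+ {suc k} g = cong (λ s → + g 0F ℤ.+ s) (sumℤ-tabulate-+ (g ∘ Data.Fin.suc))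

module Automaton {m k : ℕ} {State : Set} (start : State) (step : State → Fin m → State)
                 (colour : State → Fin k) (value : Fin k → ℕ) where

  state : Vertex m → State
  state []      = start
  state (i ∷ v) = step (state v) i

  label : State → ℕ
  label s = value (colour s)

  labeling : Labeling m
  labeling v = + label (state v)

  childSum : State → ℕ
  childSum s = sum (tabulate (label ∘ step s))

  sumℤ-children : ∀ v → sumℤ (map (λ i → labeling (i ∷ v)) (allFin m)) ≡ + childSum (state v)
  sumℤ-children v = trans (cong sumℤ (map-tabulate {n = m} id (λ i → labeling (i ∷ v))))
                          (sumℤ-tabulate-+ (label ∘ step (state v)))

  nbrSum-[] : nbrSum labeling [] ≡ + childSum start
  nbrSum-[] = trans (cong (ℤ._+ + 0) (sumℤ-children [])) (ℤ.+-identityʳ (+ childSum start))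

  nbrSum-∷ : ∀ i v → nbrSum labeling (i ∷ v) ≡ + (childSum (step (state v) i) + label (state v))
  nbrSum-∷ i v = cong (ℤ._+ labeling v) (sumℤ-children (i ∷ v))

  proper : (∀ s i → label (step s i) ≢ label s) → Proper labeling
  proper label≢ v i = label≢ (state v) i ∘ ℤ.+-injective

  openNZ : ∀ {n} → ¬ n ∣ childSum start → (∀ s i → ¬ n ∣ childSum (step s i) + label s) →
           OpenNZ n labeling
  openNZ {n} root _     []      = root ∘ subst (λ x → + n ∣ᵤ x) nbrSum-[]
  openNZ {n} _    child (i ∷ v) = child (state v) i ∘ subst (λ x → + n ∣ᵤ x) (nbrSum-∷ i v)

  hasOrder : (r : ℕ → Fin k) → (∀ j → r (value j) ≡ j) → (∀ j → ∃ λ v → colour (state v) ≡ j) →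
             HasOrder labeling k
  hasOrder r r∘value≗id reach =
    (λ j → + value j) ,
    inverseʳ⇒injective value (strictlyInverseʳ⇒inverseʳ {f⁻¹ = r} value r∘value≗id) ∘ ℤ.+-injective ,
    (λ v → colour (state v) , refl) ,
    λ j → let (v , colour≡j) = reach j in v , cong (λ c → + value c) colour≡j

module Periodic {m k : ℕ} {State : Set} (start : State) (next : State → State)
                (colour : State → Fin k) (value : Fin k → ℕ) where

  open Automaton {m} start (λ s _ → next s) colour value public

  openNZ-periodic : ∀ {n} → ¬ n ∣ m * label (next start) →
                    (∀ s → ¬ n ∣ m * label (next (next s)) + label s) → OpenNZ n labeling
  openNZ-periodic {n} root child =
    openNZ (root ∘ subst (n ∣_) (sum-tabulate-const m _))
           (λ s _ → child s ∘ subst (n ∣_) (cong (_+ label s) (sum-tabulate-const m _)))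

-- Both labels are ≡ 1 (mod n), so every neighbour sum is ≡ m or m + 1.
module Alternating (k m : ℕ) where

  private
    n : ℕ
    n = suc k

  flip : Fin 2 → Fin 2
  flip 0F = 1F
  flip 1F = 0F

  value : Fin 2 → ℕ
  value 0F = 1
  value 1F = suc n

  open Periodic {m} 0F flip id value public

  properOpenNZ : ¬ n ∣ m → ¬ n ∣ suc m → ProperOpenNZ n labeling
  properOpenNZ n∤m n∤1+m =
    proper (λ { 0F _ () ; 1F _ () }) ,
    openNZ-periodic (∤⇒∤*suc n∤m) child
    where
    child : ∀ s → ¬ n ∣ m * label (flip (flip s)) + label s
    child 0F = ∤suc*⇒∤*+ m 1 (∤⇒∤*1 n∤1+m)
    child 1F = ∤suc*⇒∤*+ m (suc n) (∤⇒∤*suc n∤1+m)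

  order : Fin m → HasOrder labeling 2
  order i = hasOrder retraction (λ { 0F → refl ; 1F → refl })
    λ { 0F → [] , refl ; 1F → i ∷ [] , refl }
    where
    retraction : ℕ → Fin 2
    retraction 1 = 0F
    retraction _ = 1F

-- In the two cyclic labelings a vertex at depth d ≥ 1 sees m * label (d + 2) + label d, which is
-- ≡ label d - label (d + 2) (mod n): odd for Cycle4, and -2 or 1 for Cycle3.
module Cycle4 (m : ℕ) where

  next : Fin 4 → Fin 4
  next 0F = 1F
  next 1F = 2F
  next 2F = 3F
  next 3F = 0F

  value : Fin 4 → ℕ
  value 0F = 0
  value 1F = 1
  value 2F = 3
  value 3F = 2

  open Periodic {m} 0F next id value public

  properOpenNZ : 2 ∣ suc m → ProperOpenNZ 2 labeling
  properOpenNZ 2∣1+m =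
    proper (λ { 0F _ () ; 1F _ () ; 2F _ () ; 3F _ () }) ,
    openNZ-periodic (∤⇒∤*1 (∣suc⇒∤ ≤-refl 2∣1+m)) child
    where
    2∤1 : ¬ 2 ∣ 1
    2∤1 = >⇒∤ ≤-refl
    2∤3 : ¬ 2 ∣ 3
    2∤3 = ∣⇒∤suc ≤-refl ∣-refl
    child : ∀ s → ¬ 2 ∣ m * label (next (next s)) + label s
    child 0F = ∤m*[b+d]+b 2∣1+m 2∤3
    child 1F = ∤m*[b+d]+b 2∣1+m 2∤1
    child 2F = ∤m*a+[a+d] 2∣1+m 2∤3
    child 3F = ∤m*a+[a+d] 2∣1+m 2∤1

  order : Fin m → HasOrder labeling 4
  order i = hasOrder retraction (λ { 0F → refl ; 1F → refl ; 2F → refl ; 3F → refl })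
    λ { 0F → [] , refl ; 1F → i ∷ [] , refl ; 2F → i ∷ i ∷ [] , refl ; 3F → i ∷ i ∷ i ∷ [] , refl }
    where
    retraction : ℕ → Fin 4
    retraction 0 = 0F
    retraction 1 = 1F
    retraction 3 = 2F
    retraction _ = 3F

module Cycle3 (n m : ℕ) where

  next : Fin 3 → Fin 3
  next 0F = 1F
  next 1F = 2F
  next 2F = 0F

  value : Fin 3 → ℕ
  value 0F = 0
  value 1F = 1
  value 2F = 2

  open Periodic {m} 0F next id value public

  properOpenNZ : 3 ≤ n → n ∣ suc m → ProperOpenNZ n labeling
  properOpenNZ 3≤n n∣1+m =
    proper (λ { 0F _ () ; 1F _ () ; 2F _ () }) ,
    openNZ-periodic (∤⇒∤*1 (∣suc⇒∤ (<⇒≤ 3≤n) n∣1+m)) child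
    where
    child : ∀ s → ¬ n ∣ m * label (next (next s)) + label s
    child 0F = ∤m*[b+d]+b n∣1+m (>⇒∤ 3≤n)
    child 1F = ∤m*a+[a+d] n∣1+m (>⇒∤ (<⇒≤ 3≤n))
    child 2F = ∤m*a+[a+d] n∣1+m (>⇒∤ (<⇒≤ 3≤n))

  order : Fin m → HasOrder labeling 3
  order i = hasOrder retraction (λ { 0F → refl ; 1F → refl ; 2F → refl })
    λ { 0F → [] , refl ; 1F → i ∷ [] , refl ; 2F → i ∷ i ∷ [] , refl }
    where
    retraction : ℕ → Fin 3
    retraction 0 = 0F
    retraction 1 = 1F
    retraction _ = 2F

-- The root sees 0 + m (n + 1) ≡ -1 (mod n) since n ∣ m + 1; a `fork` below a `blank` sees the same
-- plus its parent's 0, and every other vertex sees only labels ≡ 1, hence a sum ≡ m + 2 ≡ 1.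
module RootSplit (k m : ℕ) where

  private
    n : ℕ
    n = suc (suc k)

  data Role : Set where
    fork blank high low : Role

  step : Role → Fin (suc m) → Role
  step fork  0F                = blank
  step fork  (Data.Fin.suc _) = high
  step blank _                 = fork
  step high  _                 = low
  step low   _                 = high

  colour : Role → Fin 3
  colour blank = 0F
  colour fork  = 1F
  colour low   = 1F
  colour high  = 2F

  value : Fin 3 → ℕ
  value 0F = 0
  value 1F = 1
  value 2F = suc n

  open Automaton {suc m} fork step colour value public

  properOpenNZ : n ∣ suc m → ProperOpenNZ n labeling
  properOpenNZ n∣1+m =
    proper (λ { fork 0F () ; fork (Data.Fin.suc _) () ; blank _ () ; high _ () ; low _ () }) ,
    openNZ root child
    where
    n∤m : ¬ n ∣ m
    n∤m = ∣suc⇒∤ (s≤s (s≤s z≤n)) n∣1+m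
    n∤2+m : ¬ n ∣ suc (suc m)
    n∤2+m = ∣⇒∤suc (s≤s (s≤s z≤n)) n∣1+m
    root : ¬ n ∣ childSum fork
    root = ∤⇒∤*suc n∤m ∘ subst (n ∣_) (sum-tabulate-const m (suc n))
    allOnes : ¬ n ∣ childSum high + 1
    allOnes = ∤suc*⇒∤*+ (suc m) 1 (∤⇒∤*1 n∤2+m)
              ∘ subst (n ∣_) (cong (_+ 1) (sum-tabulate-const (suc m) 1))
    child : ∀ s i → ¬ n ∣ childSum (step s i) + label s
    child fork  0F                = allOnes
    child fork  (Data.Fin.suc _) = allOnes
    child blank _                 = root ∘ subst (n ∣_) (+-identityʳ _)
    child high  _                 = ∤suc*⇒∤*+ (suc m) (suc n) (∤⇒∤*suc n∤2+m)
                                    ∘ subst (n ∣_) (cong (_+ suc n) (sum-tabulate-const (suc m) (suc n)))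
    child low   _                 = allOnes

  order : Fin m → HasOrder labeling 3
  order i = hasOrder retraction (λ { 0F → refl ; 1F → refl ; 2F → refl })
    λ { 0F → 0F ∷ [] , refl ; 1F → [] , refl ; 2F → Data.Fin.suc i ∷ [] , refl }
    where
    retraction : ℕ → Fin 3
    retraction 0 = 0F
    retraction 1 = 1F
    retraction _ = 2F

ProperOpenColouring : ℕ → ℕ → ℕ → Set
ProperOpenColouring n m k = ∃ λ (ℓ : Labeling m) → ProperOpenNZ n ℓ × HasOrder ℓ k

chiN-intro : ∀ {n m k} → ProperOpenColouring n m (suc k) →
             (∀ (ℓ : Labeling m) → ProperOpenNZ n ℓ → ¬ OrderAtMost ℓ k) → ChiN n m (suc k)
chiN-intro colouring ¬orderAtMost =
  colouring , λ ℓ _ po hasOrder → ¬orderAtMost⇒< (¬orderAtMost ℓ po) hasOrder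

χ≡2 : ∀ {k m} (let n = suc k) → ¬ n ∣ suc m → ¬ n ∣ suc (suc m) → ChiN n (suc m) 2
χ≡2 {k} {m} n∤m n∤1+m =
  chiN-intro (labeling , properOpenNZ n∤m n∤1+m , order 0F) (λ _ → proper⇒¬orderAtMost1 ∘ proj₁)
  where open Alternating k (suc m)

χ≡4 : ∀ {m} → 2 ∣ suc (suc m) → ChiN 2 (suc m) 4
χ≡4 {m} 2∣1+m = chiN-intro (labeling , properOpenNZ 2∣1+m , order 0F) (λ _ → ¬orderAtMost3 2∣1+m)
  where open Cycle4 (suc m)

colouring-3 : ∀ {k m} (let n = suc (suc k)) → n ∣ suc m ⊎ n ∣ suc (suc m) →
              ¬ (n ≡ 2 × ¬ 2 ∣ suc m) → ProperOpenColouring n (suc m) 3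
colouring-3 {k} {zero}  (inj₁ n∣1) _ = contradiction n∣1 (>⇒∤ (s≤s (s≤s z≤n)))
colouring-3 {k} {suc m} (inj₁ n∣m) _ = labeling , properOpenNZ n∣m , order 0F
  where open RootSplit k (suc m)
colouring-3 {zero}      (inj₂ 2∣1+m) ¬χ≡4 = contradiction (refl , ∣suc⇒∤ ≤-refl 2∣1+m) ¬χ≡4
colouring-3 {suc k} {m} (inj₂ n∣1+m) _    =
  labeling , properOpenNZ (s≤s (s≤s (s≤s z≤n))) n∣1+m , order 0F
  where open Cycle3 (suc (suc (suc k))) (suc m)

χ≡3 : ∀ {k m} (let n = suc (suc k)) → n ∣ suc m ⊎ n ∣ suc (suc m) → ¬ (n ≡ 2 × ¬ 2 ∣ suc m) →
      ChiN n (suc m) 3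
χ≡3 n∣m⊎n∣1+m ¬χ≡4 = chiN-intro (colouring-3 n∣m⊎n∣1+m ¬χ≡4) (λ _ → ¬orderAtMost2 n∣m⊎n∣1+m)

theorem8p3 : (n m : ℕ) → 2 ≤ n → 1 ≤ m →
    ((¬ (n ∣ m) × ¬ (n ∣ suc m)) → ChiN n m 2) ×
    ((n ≡ 2 × ¬ (2 ∣ m)) → ChiN n m 4) ×
    (¬ (¬ (n ∣ m) × ¬ (n ∣ suc m)) → ¬ (n ≡ 2 × ¬ (2 ∣ m)) → ChiN n m 3)
theorem8p3 n@(suc (suc _)) m@(suc _) (s≤s (s≤s z≤n)) (s≤s z≤n) =
  (λ (n∤m , n∤1+m) → χ≡2 n∤m n∤1+m) ,
  (λ { (refl , 2∤m) → χ≡4 (2∤⇒2∣suc 2∤m) }) ,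
  χ≡3 ∘ n∣m⊎n∣1+m
  where
  n∣m⊎n∣1+m : ¬ (¬ n ∣ m × ¬ n ∣ suc m) → n ∣ m ⊎ n ∣ suc m
  n∣m⊎n∣1+m ¬[n∤m×n∤1+m] =
    decidable-stable (n ∣? m ⊎-dec n ∣? suc m) λ n∤ → ¬[n∤m×n∤1+m] (n∤ ∘ inj₁ , n∤ ∘ inj₂)
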